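{- Let $p$ be an odd prime, $q$ a power of $p$, $k \in \mathbf{F}_p^*$ and $x \in \mathbf{P}^1(\mathbf{F}_q)$. Then: (1) $\theta_k^{2r}(x) = \theta_{ -k}^{2r}(x)$ for every nonnegative integer $r$; (2) if $\theta_k^t(x)$ is $\theta_k$-periodic for some nonnegative integer $t$, then $\theta_{ -k}^t(x)$ is $\theta_{ -k}$-periodic.
   Context: $\mathbf{P}^1(\mathbf{F}_q) = \mathbf{F}_q \cup \{\infty\}$. For $k \in \mathbf{F}_p^*$, the map $\theta_k : \mathbf{P}^1(\mathbf{F}_q) \to \mathbf{P}^1(\mathbf{F}_q)$ is defined by $\theta_k(x) = \infty$ if $x = 0$ or $x = \infty$, and $\theta_k(x) = k\,(x + x^{ -1})$ otherwise. $\theta_k^r$ denotes the $r$-fold iterate ($\theta_k^0$ is the identity). An element $y \in \mathbf{P}^1(\mathbf{F}_q)$ is $\theta_k$-periodic if $\theta_k^r(y) = y$ for some positive integer $r$. -}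

module Defs where

open import Level using (0ℓ)
open import Algebra.Bundles using (CommutativeRing)
open import Data.Nat using (ℕ; zero; suc; _≤_)
open import Data.Fin using (Fin)
open import Data.Maybe using (Maybe; just; nothing)
open import Data.Maybe.Relation.Binary.Pointwise using (Pointwise)
open import Data.Product using (Σ; ∃; _×_; _,_)
open import Relation.Nullary using (¬_; yes; no)
open import Relation.Binary.Definitions using (Decidable)
open import Relation.Binary.PropositionalEquality using (_≡_)

record FiniteField : Set₁ where
  field
    cring : CommutativeRing 0ℓ 0ℓ
  open CommutativeRing cring public
  field
    _⁻¹      : Carrier → Carrier
    0≉1      : ¬ (0# ≈ 1#)
    ⁻¹-inv   : ∀ x → ¬ (x ≈ 0#) → (x * (x ⁻¹)) ≈ 1#
    _≟_      : Decidable _≈_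
    card     : ℕ
    enum     : Fin card → Carrier
    enum-inj : ∀ i j → enum i ≈ enum j → i ≡ j
    enum-sur : ∀ x → ∃ λ i → enum i ≈ x

module _ (F : FiniteField) where
  open FiniteField F

  -- image of a natural number m in F (m · 1); elements of the prime field F_p
  fromℕ : ℕ → Carrier
  fromℕ zero    = 0#
  fromℕ (suc m) = 1# + fromℕ m

  -- P¹(F) = F ∪ {∞}, with ∞ represented by nothing
  P1 : Set
  P1 = Maybe Carrier

  _≈P_ : P1 → P1 → Set
  _≈P_ = Pointwise _≈_

  θ : Carrier → P1 → P1
  θ k nothing  = nothing
  θ k (just x) with x ≟ 0#
  ... | yes _ = nothing
  ... | no  _ = just (k * (x + (x ⁻¹)))

  θ^ : Carrier → ℕ → P1 → P1
  θ^ k zero    y = y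
  θ^ k (suc r) y = θ k (θ^ k r y)

  Periodic : Carrier → P1 → Set
  Periodic k y = Σ ℕ λ r → (1 ≤ r) × (θ^ k r y ≈P y)

{-# OPTIONS --safe #-}
module Submission where

-- θ_{-k}(y) = −θ_k(y) and θ_k(−y) = −θ_k(y), with −∞ = ∞. Hence
-- θ_{-k}^n(x) = ±θ_k^n(x), the sign being + for even n; this is (1). For (2),
-- a θ_k-period r of w = θ_k^t(x) is also one of −w, and doubles to the
-- θ_{-k}-period 2r of both, since θ_k and θ_{-k} agree on even iterates.

open import Defs
open import Level using (0ℓ)
open import Data.Nat using (ℕ; zero; suc; _^_; s≤s; z≤n)
import Data.Nat as ℕ
open import Data.Nat.Properties using (*-suc)
open import Data.Nat.Primality using (Prime)
open import Data.Empty using (⊥-elim)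
open import Data.Maybe using (just; nothing)
open import Data.Product using (_×_; _,_)
open import Data.Sum using (_⊎_; inj₁; inj₂)
import Data.Maybe.Relation.Binary.Pointwise as Pointwise
open Pointwise using (just; nothing)
open import Relation.Nullary using (¬_; yes; no)
open import Relation.Binary.Bundles using (Setoid)
open import Relation.Binary.PropositionalEquality as ≡ using (_≡_; _≢_)
import Algebra.Properties.Ring as RingProperties
import Relation.Binary.Reasoning.Setoid as SetoidReasoning

module _ (F : FiniteField) where
  open FiniteField F
  open RingProperties ring using (-‿involutive; -0#≈0#; -‿+-comm; -‿distribˡ-*; -‿distribʳ-*)

  module _ where
    open SetoidReasoning setoid

    ⁻¹-unique : ∀ {x y} → ¬ x ≈ 0# → x * y ≈ 1# → y ≈ x ⁻¹
    ⁻¹-unique {x} {y} x≉0 xy≈1 = begin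
      y                ≈⟨ *-identityʳ y ⟨
      y * 1#           ≈⟨ *-congˡ (⁻¹-inv x x≉0) ⟨
      y * (x * x ⁻¹)   ≈⟨ *-assoc y x (x ⁻¹) ⟨
      (y * x) * x ⁻¹   ≈⟨ *-congʳ (trans (*-comm y x) xy≈1) ⟩
      1# * x ⁻¹        ≈⟨ *-identityˡ (x ⁻¹) ⟩
      x ⁻¹             ∎

    ⁻¹-cong : ∀ {x y} → ¬ x ≈ 0# → ¬ y ≈ 0# → x ≈ y → x ⁻¹ ≈ y ⁻¹
    ⁻¹-cong {x} {y} x≉0 y≉0 x≈y =
      ⁻¹-unique y≉0 (trans (*-congʳ (sym x≈y)) (⁻¹-inv x x≉0))

    -‿≉0 : ∀ {x} → ¬ x ≈ 0# → ¬ (- x) ≈ 0#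
    -‿≉0 {x} x≉0 -x≈0 = x≉0 (begin
      x        ≈⟨ -‿involutive x ⟨
      - (- x)  ≈⟨ -‿cong -x≈0 ⟩
      - 0#     ≈⟨ -0#≈0# ⟩
      0#       ∎)

    -‿⁻¹-comm : ∀ {x} → ¬ x ≈ 0# → (- x) ⁻¹ ≈ - (x ⁻¹)
    -‿⁻¹-comm {x} x≉0 = sym (⁻¹-unique (-‿≉0 x≉0) (begin
      - x * - (x ⁻¹)      ≈⟨ -‿distribˡ-* x (- (x ⁻¹)) ⟨
      - (x * - (x ⁻¹))    ≈⟨ -‿cong (-‿distribʳ-* x (x ⁻¹)) ⟨
      - (- (x * x ⁻¹))    ≈⟨ -‿involutive (x * x ⁻¹) ⟩
      x * x ⁻¹            ≈⟨ ⁻¹-inv x x≉0 ⟩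
      1#                  ∎))

    x+x⁻¹-odd : ∀ {x} → ¬ x ≈ 0# → - x + (- x) ⁻¹ ≈ - (x + x ⁻¹)
    x+x⁻¹-odd {x} x≉0 = trans (+-congˡ (-‿⁻¹-comm x≉0)) (-‿+-comm x (x ⁻¹))

  P1-setoid : Setoid 0ℓ 0ℓ
  P1-setoid = Pointwise.setoid setoid

  open Setoid P1-setoid
    using () renaming (_≈_ to _≋_; refl to ≋-refl; sym to ≋-sym; trans to ≋-trans)
  open SetoidReasoning P1-setoid

  negate : P1 F → P1 F
  negate nothing  = nothing
  negate (just x) = just (- x)

  negate-cong : ∀ {y z} → y ≋ z → negate y ≋ negate z
  negate-cong nothing    = nothing
  negate-cong (just y≈z) = just (-‿cong y≈z)

  negate-involutive : ∀ y → negate (negate y) ≋ y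
  negate-involutive nothing  = nothing
  negate-involutive (just x) = just (-‿involutive x)

  θ-cong : ∀ k {y z} → y ≋ z → θ F k y ≋ θ F k z
  θ-cong k nothing = nothing
  θ-cong k {just x} {just y} (just x≈y) with x ≟ 0# | y ≟ 0#
  ... | yes _   | yes _   = nothing
  ... | yes x≈0 | no  y≉0 = ⊥-elim (y≉0 (trans (sym x≈y) x≈0))
  ... | no  x≉0 | yes y≈0 = ⊥-elim (x≉0 (trans x≈y y≈0))
  ... | no  x≉0 | no  y≉0 = just (*-congˡ (+-cong x≈y (⁻¹-cong x≉0 y≉0 x≈y)))

  θ-neg : ∀ k y → θ F (- k) y ≋ negate (θ F k y)
  θ-neg k nothing = nothing
  θ-neg k (just x) with x ≟ 0#
  ... | yes _ = nothing
  ... | no  _ = just (sym (-‿distribˡ-* k (x + x ⁻¹)))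

  θ-odd : ∀ k y → θ F k (negate y) ≋ negate (θ F k y)
  θ-odd k nothing = nothing
  θ-odd k (just x) with x ≟ 0# | (- x) ≟ 0#
  ... | yes _   | yes _    = nothing
  ... | yes x≈0 | no  -x≉0 = ⊥-elim (-x≉0 (trans (-‿cong x≈0) -0#≈0#))
  ... | no  x≉0 | yes -x≈0 = ⊥-elim (-‿≉0 x≉0 -x≈0)
  ... | no  x≉0 | no  _    =
    just (trans (*-congˡ (x+x⁻¹-odd x≉0)) (sym (-‿distribʳ-* k (x + x ⁻¹))))

  θ^-cong : ∀ k n {y z} → y ≋ z → θ^ F k n y ≋ θ^ F k n z
  θ^-cong k zero    y≈z = y≈z
  θ^-cong k (suc n) y≈z = θ-cong k (θ^-cong k n y≈z)

  θ^-+ : ∀ k m n y → θ^ F k (m ℕ.+ n) y ≡ θ^ F k m (θ^ F k n y)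
  θ^-+ k zero    n y = ≡.refl
  θ^-+ k (suc m) n y = ≡.cong (θ F k) (θ^-+ k m n y)

  θ^-odd : ∀ k n y → θ^ F k n (negate y) ≋ negate (θ^ F k n y)
  θ^-odd k zero    y = ≋-refl
  θ^-odd k (suc n) y = ≋-trans (θ-cong k (θ^-odd k n y)) (θ-odd k (θ^ F k n y))

  θ-neg-neg : ∀ k y → θ F (- k) (θ F (- k) y) ≋ θ F k (θ F k y)
  θ-neg-neg k y = begin
    θ F (- k) (θ F (- k) y)           ≈⟨ θ-neg k (θ F (- k) y) ⟩
    negate (θ F k (θ F (- k) y))      ≈⟨ negate-cong (θ-cong k (θ-neg k y)) ⟩
    negate (θ F k (negate (θ F k y))) ≈⟨ negate-cong (θ-odd k (θ F k y)) ⟩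
    negate (negate (θ F k (θ F k y))) ≈⟨ negate-involutive (θ F k (θ F k y)) ⟩
    θ F k (θ F k y)                   ∎

  θ^-neg-even : ∀ k r y → θ^ F (- k) (2 ℕ.* r) y ≋ θ^ F k (2 ℕ.* r) y
  θ^-neg-even k zero    y = ≋-refl
  θ^-neg-even k (suc r) y =
    ≡.subst (λ n → θ^ F (- k) n y ≋ θ^ F k n y) (≡.sym (*-suc 2 r))
      (≋-trans (θ-cong (- k) (θ-cong (- k) (θ^-neg-even k r y)))
               (θ-neg-neg k (θ^ F k (2 ℕ.* r) y)))

  θ^-neg : ∀ k n y → θ^ F (- k) n y ≋ θ^ F k n y ⊎ θ^ F (- k) n y ≋ negate (θ^ F k n y)
  θ^-neg k zero    y = inj₁ ≋-refl
  θ^-neg k (suc n) y with θ^-neg k n y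
  ... | inj₁ same = inj₂ (≋-trans (θ-cong (- k) same) (θ-neg k (θ^ F k n y)))
  ... | inj₂ opposite = inj₁ (begin
    θ F (- k) (θ^ F (- k) n y)                ≈⟨ θ-cong (- k) opposite ⟩
    θ F (- k) (negate (θ^ F k n y))           ≈⟨ θ-neg k (negate (θ^ F k n y)) ⟩
    negate (θ F k (negate (θ^ F k n y)))      ≈⟨ negate-cong (θ-odd k (θ^ F k n y)) ⟩
    negate (negate (θ^ F k (suc n) y))        ≈⟨ negate-involutive (θ^ F k (suc n) y) ⟩
    θ^ F k (suc n) y                          ∎)

  θ^-periodic-multiple : ∀ k r w → θ^ F k r w ≋ w → ∀ j → θ^ F k (j ℕ.* r) w ≋ w
  θ^-periodic-multiple k r w periodic zero    = ≋-refl
  θ^-periodic-multiple k r w periodic (suc j) = begin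
    θ^ F k (r ℕ.+ j ℕ.* r) w      ≡⟨ θ^-+ k r (j ℕ.* r) w ⟩
    θ^ F k r (θ^ F k (j ℕ.* r) w) ≈⟨ θ^-cong k r (θ^-periodic-multiple k r w periodic j) ⟩
    θ^ F k r w                    ≈⟨ periodic ⟩
    w                             ∎

  Periodic-resp : ∀ {k v w} → v ≋ w → Periodic F k w → Periodic F k v
  Periodic-resp {k} {v} {w} v≈w (r , 1≤r , periodic) = r , 1≤r , (begin
    θ^ F k r v ≈⟨ θ^-cong k r v≈w ⟩
    θ^ F k r w ≈⟨ periodic ⟩
    w          ≈⟨ ≋-sym v≈w ⟩
    v          ∎)

  Periodic-negate : ∀ {k w} → Periodic F k w → Periodic F k (negate w)
  Periodic-negate {k} {w} (r , 1≤r , periodic) =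
    r , 1≤r , ≋-trans (θ^-odd k r w) (negate-cong periodic)

  Periodic-neg : ∀ {k w} → Periodic F k w → Periodic F (- k) w
  Periodic-neg {k} {w} (suc r , _ , periodic) =
    2 ℕ.* suc r , s≤s z≤n ,
    ≋-trans (θ^-neg-even k (suc r) w) (θ^-periodic-multiple k (suc r) w periodic 2)

  Periodic-θ^-neg : ∀ k x t → Periodic F k (θ^ F k t x) → Periodic F (- k) (θ^ F (- k) t x)
  Periodic-θ^-neg k x t periodic with θ^-neg k t x
  ... | inj₁ same     = Periodic-resp same (Periodic-neg periodic)
  ... | inj₂ opposite = Periodic-resp opposite (Periodic-neg (Periodic-negate periodic))

open import Data.Nat using (_*_)

lemma2p1 : (p : ℕ) → Prime p → p ≢ 2 →
    (n : ℕ) → (F : FiniteField) → FiniteField.card F ≡ p ^ n →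
    (m : ℕ) → ¬ (FiniteField._≈_ F (fromℕ F m) (FiniteField.0# F)) →
    (x : P1 F) →
      ((r : ℕ) → _≈P_ F (θ^ F (fromℕ F m) (2 * r) x)
                        (θ^ F (FiniteField.-_ F (fromℕ F m)) (2 * r) x))
      × ((t : ℕ) → Periodic F (fromℕ F m) (θ^ F (fromℕ F m) t x)
                 → Periodic F (FiniteField.-_ F (fromℕ F m))
                              (θ^ F (FiniteField.-_ F (fromℕ F m)) t x))
lemma2p1 _ _ _ _ F _ m _ x =
  (λ r → Setoid.sym (P1-setoid F) (θ^-neg-even F k r x)) , Periodic-θ^-neg F k x
  where k = fromℕ F m
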